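{- Let $\Sigma$ be an alphabet with converse and $S$ a CFCST system over $\Sigma$. All rules of the calculus $\mathsf{Km}(S)\mathsf{L}$ are invertible: for every instance of a rule, if its conclusion is derivable in $\mathsf{Km}(S)\mathsf{L}$ then each of its premises is derivable in $\mathsf{Km}(S)\mathsf{L}$.
   Context: Alphabet with converse: finite $\Sigma$ with involution $\chi\mapsto\overline{\chi}$; $\overline{\chi_1\cdots\chi_n}=\overline{\chi_n}\cdots\overline{\chi_1}$, $\overline{\varepsilon}=\varepsilon$. A CFCST system $S$ is a set of rules $\chi\to s$ ($\chi\in\Sigma$, $s\in\Sigma^*$) closed under $\chi\to s\in S\Rightarrow\overline{\chi}\to\overline{s}\in S$; $L_S(\chi)$ is the set of strings obtainable from $\chi$ by zero or more rewrites $t\chi't'\mapsto ts't'$ with $\chi'\to s'\in S$. Formulas: $\phi::=p\mid\overline{p}\mid\phi\vee\phi\mid\phi\wedge\phi\mid\langle\chi\rangle\phi\mid[\chi]\phi$. Labelled sequents $\mathcal{R}\Rightarrow\Gamma$: $\mathcal{R}$ a multiset of relational atoms $R_\chi wu$, $\Gamma$ a multiset of labelled formulas $w:\phi$. Propagation graph: vertices the labels of the sequent, edges $(w,u,\chi)$ and $(u,w,\overline{\chi})$ for each $R_\chi wu\in\mathcal{R}$; a propagation path's string is the sequence of edge labels (length-$0$ path: $\varepsilon$). $\mathsf{Km}(S)\mathsf{L}$ has the rules: $(id)$: $\mathcal{R}\Rightarrow w:p,w:\overline{p},\Gamma$; $(\vee_r)$: $\mathcal{R}\Rightarrow w:\phi,w:\psi,\Gamma$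 / $\mathcal{R}\Rightarrow w:\phi\vee\psi,\Gamma$; $(\wedge_r)$: $\mathcal{R}\Rightarrow w:\phi,\Gamma$ and $\mathcal{R}\Rightarrow w:\psi,\Gamma$ / $\mathcal{R}\Rightarrow w:\phi\wedge\psi,\Gamma$; $([\chi])$: $\mathcal{R},R_\chi wu\Rightarrow u:\phi,\Gamma$ / $\mathcal{R}\Rightarrow w:[\chi]\phi,\Gamma$ with $u$ not in the conclusion; $(Pr_{\langle\chi\rangle})$: $\mathcal{R}\Rightarrow w:\langle\chi\rangle\phi,u:\phi,\Gamma$ / $\mathcal{R}\Rightarrow w:\langle\chi\rangle\phi,\Gamma$, provided some propagation path from $w$ to $u$ has string in $L_S(\chi)$. -}

module Defs where

open import Data.Nat using (ℕ)
open import Data.Fin using (Fin)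
open import Data.List using (List; []; _∷_; _++_; [_]; map; reverse)
open import Data.List.Membership.Propositional using (_∈_)
open import Data.List.Relation.Unary.All using (All)
open import Data.List.Relation.Binary.Permutation.Propositional using (_↭_)
open import Data.List.Relation.Binary.Pointwise using (Pointwise)
open import Data.Product using (Σ; ∃; _×_; _,_)
open import Relation.Binary.PropositionalEquality using (_≡_; _≢_)
open import Relation.Binary.Construct.Closure.ReflexiveTransitive using (Star)

-- An alphabet with converse: the finite alphabet Fin n with an involution conv.
Involutive : {n : ℕ} → (Fin n → Fin n) → Set
Involutive conv = ∀ x → conv (conv x) ≡ x

convStr : {n : ℕ} → (Fin n → Fin n) → List (Fin n) → List (Fin n)
convStr conv s = reverse (map conv s)

-- A CFCST system: a set (predicate) of rules χ → s, closed under converse.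
IsCFCST : {n : ℕ} → (Fin n → Fin n) → (Fin n → List (Fin n) → Set) → Set
IsCFCST conv S = ∀ χ s → S χ s → S (conv χ) (convStr conv s)

-- Formulas (propositional atoms indexed by ℕ; nvar p is the negated atom p̄).
infixr 30 _∨_ _∧_
infix 40 ⟨_⟩_ ⟦_⟧_

data Formula (n : ℕ) : Set where
  var  : ℕ → Formula n
  nvar : ℕ → Formula n
  _∨_  : Formula n → Formula n → Formula n
  _∧_  : Formula n → Formula n → Formula n
  ⟨_⟩_ : Fin n → Formula n → Formula n
  ⟦_⟧_ : Fin n → Formula n → Formula n

module Calculus (n : ℕ) (conv : Fin n → Fin n) (S : Fin n → List (Fin n) → Set) where

  Σ' : Set
  Σ' = Fin n

  data Step : List Σ' → List Σ' → Set where
    step : ∀ t χ' s' t' → S χ' s' → Step (t ++ [ χ' ] ++ t') (t ++ s' ++ t')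

  L : Σ' → List Σ' → Set
  L χ s = Star Step [ χ ] s

  Label : Set
  Label = ℕ

  -- relational atom R_χ w u  is  (χ , w , u)
  RelAtom : Set
  RelAtom = Σ' × Label × Label

  LFormula : Set
  LFormula = Label × Formula n

  -- labelled sequent R ⇒ Γ (lists read as multisets; see _≈S_)
  Sequent : Set
  Sequent = List RelAtom × List LFormula

  data Path (R : List RelAtom) : Label → Label → List Σ' → Set where
    nil : ∀ {w} → Path R w w []
    fwd : ∀ {χ w v u s} → (χ , w , v) ∈ R → Path R v u s → Path R w u (χ ∷ s)
    bwd : ∀ {χ w v u s} → (χ , v , w) ∈ R → Path R v u s → Path R w u (conv χ ∷ s)

  FreshIn : Label → Sequent → Set
  FreshIn u (R , Γ) =
    All (λ { (χ , a , b) → (u ≢ a) × (u ≢ b) }) R × All (λ { (a , φ) → u ≢ a }) Γ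

  data Rule : List Sequent → Sequent → Set where
    id   : ∀ {R Γ w p} → Rule [] (R , (w , var p) ∷ (w , nvar p) ∷ Γ)
    ∨r   : ∀ {R Γ w φ ψ} →
           Rule [ (R , (w , φ) ∷ (w , ψ) ∷ Γ) ] (R , (w , φ ∨ ψ) ∷ Γ)
    ∧r   : ∀ {R Γ w φ ψ} →
           Rule ((R , (w , φ) ∷ Γ) ∷ (R , (w , ψ) ∷ Γ) ∷ []) (R , (w , φ ∧ ψ) ∷ Γ)
    box  : ∀ {R Γ w u χ φ} → FreshIn u (R , (w , ⟦ χ ⟧ φ) ∷ Γ) →
           Rule [ ((χ , w , u) ∷ R , (u , φ) ∷ Γ) ] (R , (w , ⟦ χ ⟧ φ) ∷ Γ)
    prop : ∀ {R Γ w u χ φ s} → Path R w u s → L χ s →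
           Rule [ (R , (w , ⟨ χ ⟩ φ) ∷ (u , φ) ∷ Γ) ] (R , (w , ⟨ χ ⟩ φ) ∷ Γ)

  _≈S_ : Sequent → Sequent → Set
  (R , Γ) ≈S (R' , Γ') = (R ↭ R') × (Γ ↭ Γ')

  Instance : List Sequent → Sequent → Set
  Instance ps c = ∃ λ ps' → ∃ λ c' →
    Rule ps' c' × (c ≈S c') × Pointwise _≈S_ ps ps'

  data Derivable : Sequent → Set where
    der : ∀ {ps c} → Instance ps c → All Derivable ps → Derivable c

-- Label substitution combined with weakening is height-preserving admissible:
-- in the (box) case the eigenlabel is first moved to a label fresh for the
-- new conclusion. Inversion of (∨), (∧) and (□) then goes by induction on the
-- height of a derivation: if the inverted formula is principal in the last
-- rule, its premise is already the goal (for (□) after substituting the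
-- requested label for the eigenlabel, so no freshness of that label is
-- needed); otherwise the inversion is pushed into the premises and the last
-- rule reapplied, a (□) rule with its eigenlabel renamed apart. The
-- propagation rule only adds a formula, so it is inverted by weakening.
module Submission where

open import Defs
open import Data.Nat using (ℕ; suc; _≤_; _⊔_; s≤s; _≟_)
open import Data.Nat.Properties using (>⇒≢; n≤1+n; m≤m⊔n; m≤n⊔m)
open import Data.Fin using (Fin)
open import Data.List using (List; []; _∷_; _++_; [_]; map)
open import Data.List.Properties using (map-id; map-cong-local; ++-identityʳ)
open import Data.List.Extrema.Nat using (max; xs≤max)
open import Data.List.Relation.Unary.All as All using (All; []; _∷_)
open import Data.List.Relation.Unary.All.Properties using (map⁻)
open import Data.List.Relation.Unary.Any using (here; there)
open import Data.List.Membership.Propositional.Properties using (∈-map⁺; ∈-++⁺ʳ; ∈-∃++)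
open import Data.List.Relation.Binary.Subset.Propositional using (_⊆_)
open import Data.List.Relation.Binary.Permutation.Propositional
  using (_↭_; ↭-refl; ↭-sym; ↭-trans; ↭-reflexive; prep)
open import Data.List.Relation.Binary.Permutation.Propositional.Properties
  using (∈-resp-↭; drop-∷; shift; shifts; ++⁺ˡ; ++⁺ʳ; ++-comm; map⁺)
open import Data.List.Relation.Binary.Pointwise as Pointwise using (Pointwise; []; _∷_)
open import Data.Product using (∃; _×_; _,_; proj₁; proj₂)
open import Data.Sum using (_⊎_; inj₁; inj₂)
open import Data.Empty using (⊥-elim)
open import Relation.Nullary using (yes; no)
open import Relation.Binary.PropositionalEquality
  using (_≡_; _≢_; refl; sym; trans; cong; cong₂; subst)

∷↭∷⁻ : ∀ {ℓ} {A : Set ℓ} {a b : A} {xs ys} → a ∷ xs ↭ b ∷ ys →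
       (a ≡ b × xs ↭ ys) ⊎ ∃ λ zs → xs ↭ b ∷ zs × ys ↭ a ∷ zs
∷↭∷⁻ {a = a} {b} p with ∈-resp-↭ (↭-sym p) (here refl)
... | here refl = inj₁ (refl , drop-∷ p)
... | there b∈xs with ∈-∃++ b∈xs
...   | us , vs , refl = inj₂ (us ++ vs , shift b us vs ,
                                drop-∷ (↭-trans (↭-sym p) (shift b (a ∷ us) vs)))

∃-fresh : (xs : List ℕ) → ∃ λ v → All (v ≢_) xs
∃-fresh xs = suc (max 0 xs) , All.map (λ x≤max → >⇒≢ (s≤s x≤max)) (xs≤max 0 xs)

_[_≔_] : (ℕ → ℕ) → ℕ → ℕ → ℕ → ℕ
(ρ [ v ≔ v' ]) x with x ≟ v
... | yes _ = v'
... | no  _ = ρ x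

[≔]-same : ∀ ρ v v' → (ρ [ v ≔ v' ]) v ≡ v'
[≔]-same ρ v v' with v ≟ v
... | yes _   = refl
... | no  v≢v = ⊥-elim (v≢v refl)

[≔]-other : ∀ ρ {v v' x} → v ≢ x → (ρ [ v ≔ v' ]) x ≡ ρ x
[≔]-other ρ {v} {x = x} v≢x with x ≟ v
... | yes x≡v = ⊥-elim (v≢x (sym x≡v))
... | no  _   = refl

module Inversion (n : ℕ) (conv : Fin n → Fin n) (S : Fin n → List (Fin n) → Set) where
  open Calculus n conv S

  renameAtom : (Label → Label) → RelAtom → RelAtom
  renameAtom ρ (χ , w , u) = χ , ρ w , ρ u

  renameLFormula : (Label → Label) → LFormula → LFormula
  renameLFormula ρ (w , φ) = ρ w , φ

  labels : Sequent → List Label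
  labels ([] , Γ)              = map proj₁ Γ
  labels ((_ , w , u) ∷ R , Γ) = w ∷ u ∷ labels (R , Γ)

  avoids-labels⇒FreshIn : ∀ {v} σ → All (v ≢_) (labels σ) → FreshIn v σ
  avoids-labels⇒FreshIn ([] , Γ)    v∉Γ = [] , map⁻ v∉Γ
  avoids-labels⇒FreshIn (_ ∷ R , Γ) (v≢w ∷ v≢u ∷ v∉σ) with avoids-labels⇒FreshIn (R , Γ) v∉σ
  ... | v∉R , v∉Γ = (v≢w , v≢u) ∷ v∉R , v∉Γ

  freshLabel : (σ : Sequent) → ∃ λ v → FreshIn v σ
  freshLabel σ with ∃-fresh (labels σ)
  ... | v , v∉σ = v , avoids-labels⇒FreshIn σ v∉σ

  rename-fresh : ∀ ρ {v v' R Γ} → FreshIn v (R , Γ) →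
                 map (renameAtom (ρ [ v ≔ v' ])) R ≡ map (renameAtom ρ) R ×
                 map (renameLFormula (ρ [ v ≔ v' ])) Γ ≡ map (renameLFormula ρ) Γ
  rename-fresh ρ (v∉R , v∉Γ) =
    map-cong-local (All.map (λ { (v≢a , v≢b) →
      cong₂ (λ a b → _ , a , b) ([≔]-other ρ v≢a) ([≔]-other ρ v≢b) }) v∉R) ,
    map-cong-local (All.map (λ v≢a → cong (_, _) ([≔]-other ρ v≢a)) v∉Γ)

  Path-rename : ∀ ρ {R w u s} → Path R w u s → Path (map (renameAtom ρ) R) (ρ w) (ρ u) s
  Path-rename ρ nil       = nil
  Path-rename ρ (fwd e p) = fwd (∈-map⁺ (renameAtom ρ) e) (Path-rename ρ p)
  Path-rename ρ (bwd e p) = bwd (∈-map⁺ (renameAtom ρ) e) (Path-rename ρ p)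

  Path-mono : ∀ {R R' w u s} → R ⊆ R' → Path R w u s → Path R' w u s
  Path-mono R⊆R' nil       = nil
  Path-mono R⊆R' (fwd e p) = fwd (R⊆R' e) (Path-mono R⊆R' p)
  Path-mono R⊆R' (bwd e p) = bwd (R⊆R' e) (Path-mono R⊆R' p)

  ≈S-refl : ∀ {σ} → σ ≈S σ
  ≈S-refl = ↭-refl , ↭-refl

  ≈S-sym : ∀ {σ τ} → σ ≈S τ → τ ≈S σ
  ≈S-sym (R↭ , Γ↭) = ↭-sym R↭ , ↭-sym Γ↭

  ≈S-trans : ∀ {σ τ υ} → σ ≈S τ → τ ≈S υ → σ ≈S υ
  ≈S-trans (R↭ , Γ↭) (R↭' , Γ↭') = ↭-trans R↭ R↭' , ↭-trans Γ↭ Γ↭'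

  -- Derivations of height at most k; a leaf has height 1.
  data Derivable≤ : ℕ → Sequent → Set where
    der : ∀ {k ps c} → Instance ps c → All (Derivable≤ k) ps → Derivable≤ (suc k) c

  rule : ∀ {k ps c} → Rule ps c → All (Derivable≤ k) ps → Derivable≤ (suc k) c
  rule r = der (_ , _ , r , ≈S-refl , Pointwise.refl ≈S-refl)

  Derivable≤-resp : ∀ {k σ τ} → Derivable≤ k σ → σ ≈S τ → Derivable≤ k τ
  Derivable≤-resp (der (ps' , c' , r , σ≈c' , pw) ds) σ≈τ =
    der (ps' , c' , r , ≈S-trans (≈S-sym σ≈τ) σ≈c' , pw) ds

  All-Derivable≤-resp : ∀ {k ps ps'} → All (Derivable≤ k) ps → Pointwise _≈S_ ps ps' →
                        All (Derivable≤ k) ps'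
  All-Derivable≤-resp []       []         = []
  All-Derivable≤-resp (d ∷ ds) (σ≈ ∷ pw) = Derivable≤-resp d σ≈ ∷ All-Derivable≤-resp ds pw

  Derivable≤-mono : ∀ {k m σ} → k ≤ m → Derivable≤ k σ → Derivable≤ m σ
  All-Derivable≤-mono : ∀ {k m ps} → k ≤ m → All (Derivable≤ k) ps → All (Derivable≤ m) ps
  Derivable≤-mono (s≤s k≤m) (der i ds) = der i (All-Derivable≤-mono k≤m ds)
  All-Derivable≤-mono k≤m []       = []
  All-Derivable≤-mono k≤m (d ∷ ds) = Derivable≤-mono k≤m d ∷ All-Derivable≤-mono k≤m ds

  Derivable⇒Derivable≤ : ∀ {σ} → Derivable σ → ∃ λ k → Derivable≤ k σ
  All-Derivable⇒Derivable≤ : ∀ {ps} → All Derivable ps → ∃ λ k → All (Derivable≤ k) ps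
  Derivable⇒Derivable≤ (der i ds) with All-Derivable⇒Derivable≤ ds
  ... | k , ds≤ = suc k , der i ds≤
  All-Derivable⇒Derivable≤ [] = 0 , []
  All-Derivable⇒Derivable≤ (d ∷ ds) with Derivable⇒Derivable≤ d | All-Derivable⇒Derivable≤ ds
  ... | k , d≤ | m , ds≤ = k ⊔ m , Derivable≤-mono (m≤m⊔n k m) d≤ ∷ All-Derivable≤-mono (m≤n⊔m k m) ds≤

  Derivable≤⇒Derivable : ∀ {k σ} → Derivable≤ k σ → Derivable σ
  All-Derivable≤⇒Derivable : ∀ {k ps} → All (Derivable≤ k) ps → All Derivable ps
  Derivable≤⇒Derivable (der i ds) = der i (All-Derivable≤⇒Derivable ds)
  All-Derivable≤⇒Derivable []       = []
  All-Derivable≤⇒Derivable (d ∷ ds) = Derivable≤⇒Derivable d ∷ All-Derivable≤⇒Derivable ds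

  -- Recursion is on the height k: premises are transported along ≈S, so they
  -- are not structural subterms.
  relabel-weaken : ∀ k {R Γ} → Derivable≤ k (R , Γ) → (ρ : Label → Label) (Γ' : List LFormula) →
                   Derivable≤ k (map (renameAtom ρ) R , map (renameLFormula ρ) Γ ++ Γ')
  relabel-weaken-rule : ∀ k {ps R Γ} → Rule ps (R , Γ) → All (Derivable≤ k) ps →
                        (ρ : Label → Label) (Γ' : List LFormula) →
                        Derivable≤ (suc k) (map (renameAtom ρ) R , map (renameLFormula ρ) Γ ++ Γ')
  relabel-eigen : ∀ k {χ w v φ R Γ ψ} → FreshIn v (R , (w , ψ) ∷ Γ) →
                  Derivable≤ k ((χ , w , v) ∷ R , (v , φ) ∷ Γ) →
                  (ρ : Label → Label) (v' : Label) (Γ' : List LFormula) →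
                  Derivable≤ k ((χ , ρ w , v') ∷ map (renameAtom ρ) R ,
                                (v' , φ) ∷ map (renameLFormula ρ) Γ ++ Γ')

  relabel-weaken (suc k) (der (ps' , (R' , Γ'') , r , (R↭ , Γ↭) , pw) ds) ρ Γ' =
    Derivable≤-resp (relabel-weaken-rule k r (All-Derivable≤-resp ds pw) ρ Γ')
      (↭-sym (map⁺ (renameAtom ρ) R↭) , ↭-sym (++⁺ʳ Γ' (map⁺ (renameLFormula ρ) Γ↭)))

  relabel-weaken-rule k id               []            ρ Γ' = rule id []
  relabel-weaken-rule k ∨r               (d ∷ [])      ρ Γ' = rule ∨r (relabel-weaken k d ρ Γ' ∷ [])
  relabel-weaken-rule k ∧r               (d ∷ d' ∷ []) ρ Γ' =
    rule ∧r (relabel-weaken k d ρ Γ' ∷ relabel-weaken k d' ρ Γ' ∷ [])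
  relabel-weaken-rule k (prop path s∈L)  (d ∷ [])      ρ Γ' =
    rule (prop (Path-rename ρ path) s∈L) (relabel-weaken k d ρ Γ' ∷ [])
  relabel-weaken-rule k {R = R} (box {Γ = Γ} {w} {χ = χ} {φ} fresh) (d ∷ []) ρ Γ' =
    rule (box (proj₂ v'-fresh)) (relabel-eigen k fresh d ρ (proj₁ v'-fresh) Γ' ∷ [])
    where v'-fresh = freshLabel (map (renameAtom ρ) R , (ρ w , ⟦ χ ⟧ φ) ∷ map (renameLFormula ρ) Γ ++ Γ')

  relabel-eigen k {χ} {w} {v} {φ} {R} {Γ} (v∉R , v≢w ∷ v∉Γ) d ρ v' Γ' =
    subst (Derivable≤ k) (cong₂ _,_ atoms formulas) (relabel-weaken k d (ρ [ v ≔ v' ]) Γ')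
    where
      atoms : map (renameAtom (ρ [ v ≔ v' ])) ((χ , w , v) ∷ R) ≡ (χ , ρ w , v') ∷ map (renameAtom ρ) R
      atoms = cong₂ _∷_ (cong₂ (λ a b → χ , a , b) ([≔]-other ρ v≢w) ([≔]-same ρ v v'))
                        (proj₁ (rename-fresh ρ (v∉R , v∉Γ)))
      formulas : map (renameLFormula (ρ [ v ≔ v' ])) ((v , φ) ∷ Γ) ++ Γ' ≡
                 (v' , φ) ∷ map (renameLFormula ρ) Γ ++ Γ'
      formulas = cong₂ (λ a Δ → (a , φ) ∷ Δ ++ Γ') ([≔]-same ρ v v') (proj₂ (rename-fresh ρ (v∉R , v∉Γ)))

  rename-eigenlabel : ∀ {k χ w v φ R Γ ψ} → FreshIn v (R , (w , ψ) ∷ Γ) →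
                      Derivable≤ k ((χ , w , v) ∷ R , (v , φ) ∷ Γ) → (v' : Label) →
                      Derivable≤ k ((χ , w , v') ∷ R , (v' , φ) ∷ Γ)
  rename-eigenlabel {k} {χ} {w} {φ = φ} {R} {Γ} fresh d v' =
    Derivable≤-resp (relabel-eigen k fresh d (λ x → x) v' [])
      (↭-reflexive (cong ((χ , w , v') ∷_) (map-id R)) ,
       ↭-reflexive (cong ((v' , φ) ∷_) (trans (cong (_++ []) (map-id Γ)) (++-identityʳ Γ))))

  weaken : ∀ {k R a Γ} B → Derivable≤ k (R , a ∷ Γ) → Derivable≤ k (R , a ∷ B ∷ Γ)
  weaken {k} {R} {a} {Γ} B d =
    Derivable≤-resp (relabel-weaken k d (λ x → x) [ B ])
      (↭-reflexive (map-id R) ,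
       prep a (↭-trans (↭-reflexive (cong (_++ [ B ]) (map-id Γ))) (++-comm Γ [ B ])))

  -- invert-principal covers F as the first formula of the last rule's conclusion;
  -- F-not-negated-atom excludes the second principal formula w : p̄ of (id).
  module PermutationInversion (F : LFormula) (Rs : List RelAtom) (Fs : List LFormula)
    (F-not-negated-atom : ∀ w p → F ≢ (w , nvar p))
    (invert-principal : ∀ {k ps R Δ} → Rule ps (R , F ∷ Δ) → All (Derivable≤ k) ps →
                        Derivable≤ k (Rs ++ R , Fs ++ Δ)) where

    invert : ∀ k {R Γ Δ} → Derivable≤ k (R , Γ) → Γ ↭ F ∷ Δ → Derivable≤ k (Rs ++ R , Fs ++ Δ)
    invert-last : ∀ k {ps R Γ Δ} → Rule ps (R , Γ) → All (Derivable≤ k) ps → Γ ↭ F ∷ Δ →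
                  Derivable≤ (suc k) (Rs ++ R , Fs ++ Δ)

    invert (suc k) (der (ps' , (R' , Γ') , r , (R↭ , Γ↭) , pw) ds) Γ↭FΔ =
      Derivable≤-resp (invert-last k r (All-Derivable≤-resp ds pw) (↭-trans (↭-sym Γ↭) Γ↭FΔ))
        (++⁺ˡ Rs (↭-sym R↭) , ↭-refl)

    invert-premise : ∀ k {R Γ Θ} pre → Derivable≤ k (R , pre ++ Γ) → Γ ↭ F ∷ Θ →
                     Derivable≤ k (Rs ++ R , pre ++ Fs ++ Θ)
    invert-premise k pre d Γ↭FΘ =
      Derivable≤-resp (invert k d (↭-trans (++⁺ˡ pre Γ↭FΘ) (shift F pre _))) (↭-refl , shifts Fs pre)

    restore-side : ∀ {k R} pre {Θ Δ} → Derivable≤ k (Rs ++ R , pre ++ Fs ++ Θ) → Δ ↭ pre ++ Θ →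
                   Derivable≤ k (Rs ++ R , Fs ++ Δ)
    restore-side pre d Δ↭ = Derivable≤-resp d (↭-refl , ↭-sym (↭-trans (++⁺ˡ Fs Δ↭) (shifts Fs pre)))

    principal : ∀ k {ps R a Γ Δ} → Rule ps (R , a ∷ Γ) → All (Derivable≤ k) ps → a ≡ F → Γ ↭ Δ →
                Derivable≤ (suc k) (Rs ++ R , Fs ++ Δ)
    principal k {ps} {R} {Γ = Γ} r ds a≡F Γ↭Δ =
      Derivable≤-resp (Derivable≤-mono (n≤1+n k) (invert-principal r' ds)) (↭-refl , ++⁺ˡ Fs Γ↭Δ)
      where r' = subst (λ a → Rule ps (R , a ∷ Γ)) a≡F r

    invert-last k id [] Γ↭FΔ with ∷↭∷⁻ Γ↭FΔ
    ... | inj₁ (a≡F , Γ↭Δ) = principal k id [] a≡F Γ↭Δ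
    ... | inj₂ (Θ , Γ↭FΘ , Δ↭) with ∷↭∷⁻ Γ↭FΘ
    ...   | inj₁ (b≡F , _)      = ⊥-elim (F-not-negated-atom _ _ (sym b≡F))
    ...   | inj₂ (Θ' , _ , Θ↭) = restore-side (_ ∷ _ ∷ []) (rule id []) (↭-trans Δ↭ (prep _ Θ↭))
    invert-last k ∨r (d ∷ []) Γ↭FΔ with ∷↭∷⁻ Γ↭FΔ
    ... | inj₁ (a≡F , Γ↭Δ)    = principal k ∨r (d ∷ []) a≡F Γ↭Δ
    ... | inj₂ (Θ , Γ↭FΘ , Δ↭) = restore-side [ _ ] (rule ∨r (invert-premise k (_ ∷ _ ∷ []) d Γ↭FΘ ∷ [])) Δ↭
    invert-last k ∧r (d ∷ d' ∷ []) Γ↭FΔ with ∷↭∷⁻ Γ↭FΔ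
    ... | inj₁ (a≡F , Γ↭Δ)    = principal k ∧r (d ∷ d' ∷ []) a≡F Γ↭Δ
    ... | inj₂ (Θ , Γ↭FΘ , Δ↭) =
      restore-side [ _ ] (rule ∧r (invert-premise k [ _ ] d Γ↭FΘ ∷ invert-premise k [ _ ] d' Γ↭FΘ ∷ [])) Δ↭
    invert-last k (prop path s∈L) (d ∷ []) Γ↭FΔ with ∷↭∷⁻ Γ↭FΔ
    ... | inj₁ (a≡F , Γ↭Δ)    = principal k (prop path s∈L) (d ∷ []) a≡F Γ↭Δ
    ... | inj₂ (Θ , Γ↭FΘ , Δ↭) =
      restore-side [ _ ] (rule (prop (Path-mono (∈-++⁺ʳ Rs) path) s∈L)
                               (invert-premise k (_ ∷ _ ∷ []) d Γ↭FΘ ∷ [])) Δ↭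
    invert-last k {R = R} (box {w = w} {χ = χ} {φ} fresh) (d ∷ []) Γ↭FΔ with ∷↭∷⁻ Γ↭FΔ
    ... | inj₁ (a≡F , Γ↭Δ)    = principal k (box fresh) (d ∷ []) a≡F Γ↭Δ
    ... | inj₂ (Θ , Γ↭FΘ , Δ↭) = restore-side [ _ ] (rule (box (proj₂ v'-fresh)) (inverted ∷ [])) Δ↭
      where
        v'-fresh = freshLabel (Rs ++ R , (w , ⟦ χ ⟧ φ) ∷ Fs ++ Θ)
        v' = proj₁ v'-fresh
        inverted : Derivable≤ k ((χ , w , v') ∷ Rs ++ R , (v' , φ) ∷ Fs ++ Θ)
        inverted = Derivable≤-resp (invert-premise k [ _ ] (rename-eigenlabel fresh d v') Γ↭FΘ)
                     (shift _ Rs R , ↭-refl)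

  open PermutationInversion using (invert)

  invert-∨ : ∀ {k R Γ w φ ψ} → Derivable≤ k (R , (w , φ ∨ ψ) ∷ Γ) →
             Derivable≤ k (R , (w , φ) ∷ (w , ψ) ∷ Γ)
  invert-∨ {k} {w = w} {φ} {ψ} d =
    invert (w , φ ∨ ψ) [] ((w , φ) ∷ (w , ψ) ∷ []) (λ _ _ ()) principal k d ↭-refl
    where
      principal : ∀ {k ps R Δ} → Rule ps (R , (w , φ ∨ ψ) ∷ Δ) → All (Derivable≤ k) ps →
                  Derivable≤ k (R , (w , φ) ∷ (w , ψ) ∷ Δ)
      principal ∨r (d ∷ []) = d

  invert-∧ˡ : ∀ {k R Γ w φ ψ} → Derivable≤ k (R , (w , φ ∧ ψ) ∷ Γ) → Derivable≤ k (R , (w , φ) ∷ Γ)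
  invert-∧ˡ {k} {w = w} {φ} {ψ} d = invert (w , φ ∧ ψ) [] [ w , φ ] (λ _ _ ()) principal k d ↭-refl
    where
      principal : ∀ {k ps R Δ} → Rule ps (R , (w , φ ∧ ψ) ∷ Δ) → All (Derivable≤ k) ps →
                  Derivable≤ k (R , (w , φ) ∷ Δ)
      principal ∧r (d ∷ _ ∷ []) = d

  invert-∧ʳ : ∀ {k R Γ w φ ψ} → Derivable≤ k (R , (w , φ ∧ ψ) ∷ Γ) → Derivable≤ k (R , (w , ψ) ∷ Γ)
  invert-∧ʳ {k} {w = w} {φ} {ψ} d = invert (w , φ ∧ ψ) [] [ w , ψ ] (λ _ _ ()) principal k d ↭-refl
    where
      principal : ∀ {k ps R Δ} → Rule ps (R , (w , φ ∧ ψ) ∷ Δ) → All (Derivable≤ k) ps →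
                  Derivable≤ k (R , (w , ψ) ∷ Δ)
      principal ∧r (_ ∷ d ∷ []) = d

  invert-□ : ∀ {k R Γ w χ φ} u → Derivable≤ k (R , (w , ⟦ χ ⟧ φ) ∷ Γ) →
             Derivable≤ k ((χ , w , u) ∷ R , (u , φ) ∷ Γ)
  invert-□ {k} {w = w} {χ} {φ} u d =
    invert (w , ⟦ χ ⟧ φ) [ χ , w , u ] [ u , φ ] (λ _ _ ()) principal k d ↭-refl
    where
      principal : ∀ {k ps R Δ} → Rule ps (R , (w , ⟦ χ ⟧ φ) ∷ Δ) → All (Derivable≤ k) ps →
                  Derivable≤ k ((χ , w , u) ∷ R , (u , φ) ∷ Δ)
      principal (box fresh) (d ∷ []) = rename-eigenlabel fresh d u

  Rule-invertible≤ : ∀ {k ps c} → Rule ps c → Derivable≤ k c → All (Derivable≤ k) ps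
  Rule-invertible≤ id                  d = []
  Rule-invertible≤ ∨r                  d = invert-∨ d ∷ []
  Rule-invertible≤ ∧r                  d = invert-∧ˡ d ∷ invert-∧ʳ d ∷ []
  Rule-invertible≤ (box {u = u} _)     d = invert-□ u d ∷ []
  Rule-invertible≤ (prop {u = u} {φ = φ} _ _) d = weaken (u , φ) d ∷ []

  Instance-invertible : ∀ {ps c} → Instance ps c → Derivable c → All Derivable ps
  Instance-invertible (ps' , c' , r , c≈c' , ps≈ps') d with Derivable⇒Derivable≤ d
  ... | k , d≤ = All-Derivable≤⇒Derivable
                   (All-Derivable≤-resp (Rule-invertible≤ r (Derivable≤-resp d≤ c≈c'))
                                        (Pointwise.symmetric ≈S-sym ps≈ps'))

mainTheorem3 : (n : ℕ) (conv : Fin n → Fin n) → Involutive conv →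
               (S : Fin n → List (Fin n) → Set) → IsCFCST conv S →
               (ps : List (Calculus.Sequent n conv S)) (c : Calculus.Sequent n conv S) →
               Calculus.Instance n conv S ps c →
               Calculus.Derivable n conv S c →
               All (Calculus.Derivable n conv S) ps
mainTheorem3 n conv _ S _ _ _ = Inversion.Instance-invertible n conv S
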